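{- Let $p>3$ be a prime. Then for each $k=1,2,\ldots,(p-1)/2$, $$\sum_{j=0}^{p-2k}\binom{ -k}{k+j}\frac{(-1)^{k+j}}{\binom{k+j}{k}}\equiv\frac{3k}2\sum_{j=1}^k\frac{\binom{2j}{j}}{j}-\frac32\binom{2k}{k}\pmod p.$$
   Context: For an integer $a$ and $m\in\mathbb{N}$, $\binom{a}{m}=a(a-1)\cdots(a-m+1)/m!$ (so $\binom{ -k}{m}=(-1)^m\binom{k+m-1}{m}$). Congruences between rationals are understood in the ring of rationals whose denominators are coprime to $p$. -}

module Defs where

open import Data.Nat as ℕ using (ℕ; zero; suc)
open import Data.Nat.Divisibility using (_∣_)
open import Data.Integer as ℤ using (ℤ)
open import Data.Rational using (ℚ; 0ℚ; 1ℚ; _+_; _*_; _-_; _/_; ↥_; ↧ₙ_)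
open import Data.List using (List; foldr; map; upTo)
open import Data.Product using (_×_)
open import Relation.Nullary using (¬_)

ℕ→ℚ : ℕ → ℚ
ℕ→ℚ n = ℤ.+ n / 1

ℤ→ℚ : ℤ → ℚ
ℤ→ℚ z = z / 1

-- division of a rational by a natural number; only ever used with a
-- nonzero divisor (the zero case is a dummy value)
_÷ℕ_ : ℚ → ℕ → ℚ
q ÷ℕ zero  = 0ℚ
q ÷ℕ suc n = q * (ℤ.+ 1 / suc n)

Σ< : ℕ → (ℕ → ℚ) → ℚ
Σ< n f = foldr _+_ 0ℚ (map f (upTo n))

Π< : ℕ → (ℕ → ℚ) → ℚ
Π< n f = foldr _*_ 1ℚ (map f (upTo n))

sgn : ℕ → ℚ
sgn zero    = 1ℚ
sgn (suc n) = Data.Rational.-_ (sgn n)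

gbinom : ℤ → ℕ → ℚ
gbinom a m = Π< m (λ i → ℤ→ℚ (a ℤ.- ℤ.+ i)) ÷ℕ (m ℕ.!)

-- congruence of rationals modulo p in the ring of p-integral rationals:
-- x ≡ y (mod p) iff x - y (in lowest terms) has numerator divisible by p
-- and denominator not divisible by p.
_≡_[modℚ_] : ℚ → ℚ → ℕ → Set
x ≡ y [modℚ p ] = (p ∣ ℤ.∣ ↥ (x - y) ∣) × ¬ (p ∣ ↧ₙ (x - y))

{-# OPTIONS --safe #-}
-- Write k = a + 1 and u a j = (2a+1+j)! j! / ((a+1+j)!)²; the j-th summand is k · u a j.
-- Dividing by k, it suffices to show σ a (p−2a−1) ≡ target k, where σ a n = Σ_{j<n} u a j and
-- target k = (3/2)(Σ_{i=1}^{k} C(2i,i)/i − C(2k,k)/k); we induct on a.  For a = 0, σ is the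
-- harmonic sum H_{p−1}, which vanishes mod p by pairing 1/i with 1/(p−i).  For the step, the identity
--   (a+1) u (a+1) j + 2(2a+3+j) u a (j+1) = (a+1) u a (j+1) + 2(2a+2+j) u a j
-- telescopes over j < L to σ (a+1) L = σ a (L+2) + 3 u a 0 − (2a+3+L) · w a L / (a+1), with w a L
-- p-integral and 2a+3+L = p; and 3 u a 0 = (3/2) C(2k,k)/k = target (k+1) − target k.
module Submission where

open import Defs
open import Data.Nat using (ℕ; _<_)
open import Data.Nat.Primality using (Prime)

module Rationals where

  open import Data.Nat as ℕ using (ℕ; zero; suc; _<_; s≤s; z≤n)
  import Data.Nat.Properties as ℕₚ
  open import Data.Nat.Coprimality using (1-coprimeTo) renaming (sym to coprime-sym)
  open import Data.Integer as ℤ using (ℤ; +_; +0; +[1+_]; -[1+_])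
  import Data.Integer.Properties as ℤₚ
  open import Data.Rational using (ℚ; mkℚ; 0ℚ; 1ℚ; _+_; _*_; _-_; -_; _/_; ↥_; ↧ₙ_; toℚᵘ)
  import Data.Rational.Properties as ℚₚ
  open import Data.Rational.Unnormalised as ℚᵘ using (mkℚᵘ)
  import Data.Rational.Unnormalised.Properties as ℚᵘₚ
  open import Data.Rational.Solver using (module +-*-Solver)
  open import Data.List using (foldr; applyUpTo)
  import Data.List.Properties as List
  open import Data.Empty using (⊥-elim)
  open import Data.Sum using ([_,_]′)
  open import Relation.Binary.PropositionalEquality
  open +-*-Solver using (solve; _:+_; _:*_; _:-_; _:=_)
  open ≡-Reasoning

  ℤ→ℚ≡mkℚ : ∀ z → ℤ→ℚ z ≡ mkℚ z 0 (coprime-sym (1-coprimeTo ℤ.∣ z ∣))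
  ℤ→ℚ≡mkℚ z = ℚₚ.↥p/↧p≡p (mkℚ z 0 (coprime-sym (1-coprimeTo ℤ.∣ z ∣)))

  ℤ→ℚ-homo-+ : ∀ a b → ℤ→ℚ (a ℤ.+ b) ≡ ℤ→ℚ a + ℤ→ℚ b
  ℤ→ℚ-homo-+ a b = begin
    ℤ→ℚ (a ℤ.+ b)                  ≡⟨ cong₂ (λ x y → ℤ→ℚ (x ℤ.+ y)) (ℤₚ.*-identityʳ a) (ℤₚ.*-identityʳ b) ⟨
    ℤ→ℚ (a ℤ.* + 1 ℤ.+ b ℤ.* + 1)  ≡⟨ cong₂ _+_ (ℤ→ℚ≡mkℚ a) (ℤ→ℚ≡mkℚ b) ⟨
    ℤ→ℚ a + ℤ→ℚ b                  ∎

  ℤ→ℚ-homo-* : ∀ a b → ℤ→ℚ (a ℤ.* b) ≡ ℤ→ℚ a * ℤ→ℚ b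
  ℤ→ℚ-homo-* a b = sym (cong₂ _*_ (ℤ→ℚ≡mkℚ a) (ℤ→ℚ≡mkℚ b))

  ℤ→ℚ-homo‿- : ∀ a → ℤ→ℚ (ℤ.- a) ≡ - ℤ→ℚ a
  ℤ→ℚ-homo‿- +0       = refl
  ℤ→ℚ-homo‿- +[1+ n ] = trans (ℤ→ℚ≡mkℚ -[1+ n ]) (cong -_ (sym (ℤ→ℚ≡mkℚ +[1+ n ])))
  ℤ→ℚ-homo‿- -[1+ n ] = trans (ℤ→ℚ≡mkℚ +[1+ n ]) (cong -_ (sym (ℤ→ℚ≡mkℚ -[1+ n ])))

  ℕ→ℚ-homo-+ : ∀ m n → ℕ→ℚ (m ℕ.+ n) ≡ ℕ→ℚ m + ℕ→ℚ n
  ℕ→ℚ-homo-+ m n = ℤ→ℚ-homo-+ (+ m) (+ n)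

  ℕ→ℚ-homo-* : ∀ m n → ℕ→ℚ (m ℕ.* n) ≡ ℕ→ℚ m * ℕ→ℚ n
  ℕ→ℚ-homo-* m n = trans (cong ℤ→ℚ (ℤₚ.pos-* m n)) (ℤ→ℚ-homo-* (+ m) (+ n))

  ∣↥∣-cross-multiply : ∀ w b c → w * ℕ→ℚ b ≡ ℤ→ℚ c → ℤ.∣ ↥ w ∣ ℕ.* b ≡ ℤ.∣ c ∣ ℕ.* ↧ₙ w
  ∣↥∣-cross-multiply w@(mkℚ n d _) b c w*b≡c = begin
    ℤ.∣ n ∣ ℕ.* b                      ≡⟨ ℤₚ.abs-* n (+ b) ⟨
    ℤ.∣ n ℤ.* + b ∣                    ≡⟨ cong ℤ.∣_∣ (ℤₚ.*-identityʳ (n ℤ.* + b)) ⟨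
    ℤ.∣ n ℤ.* + b ℤ.* + 1 ∣            ≡⟨ cong ℤ.∣_∣ (ℚᵘₚ.drop-*≡* unnormalised) ⟩
    ℤ.∣ c ℤ.* (+ suc d ℤ.* + 1) ∣      ≡⟨ ℤₚ.abs-* c _ ⟩
    ℤ.∣ c ∣ ℕ.* ℤ.∣ + suc d ℤ.* + 1 ∣  ≡⟨ cong (λ x → ℤ.∣ c ∣ ℕ.* ℤ.∣ x ∣) (ℤₚ.*-identityʳ (+ suc d)) ⟩
    ℤ.∣ c ∣ ℕ.* suc d                  ∎
    where
    unnormalised : mkℚᵘ n d ℚᵘ.* mkℚᵘ (+ b) 0 ℚᵘ.≃ mkℚᵘ c 0
    unnormalised =
      ℚᵘₚ.≃-trans (ℚᵘₚ.≃-reflexive (cong (λ x → toℚᵘ w ℚᵘ.* toℚᵘ x) (sym (ℤ→ℚ≡mkℚ (+ b)))))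
        (ℚᵘₚ.≃-trans (ℚᵘₚ.≃-sym (ℚₚ.toℚᵘ-homo-* w (ℕ→ℚ b)))
          (ℚᵘₚ.≃-reflexive (cong toℚᵘ (trans w*b≡c (ℤ→ℚ≡mkℚ c)))))

  *-≢0 : ∀ {m n} → m ≢ 0 → n ≢ 0 → m ℕ.* n ≢ 0
  *-≢0 {m} m≢0 n≢0 mn≡0 = [ m≢0 , n≢0 ]′ (ℕₚ.m*n≡0⇒m≡0∨n≡0 m mn≡0)

  1/suc-*-suc : ∀ d → (+ 1 / suc d) * ℕ→ℚ (suc d) ≡ 1ℚ
  1/suc-*-suc d = trans (cong₂ _*_ (ℚₚ.normalize-coprime (1-coprimeTo (suc d))) (ℤ→ℚ≡mkℚ (+ suc d)))
                        (ℚₚ.*-inverseˡ (mkℚ (+ suc d) 0 (coprime-sym (1-coprimeTo (suc d)))))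

  ÷ℕ-*-cancel : ∀ x d → d ≢ 0 → (x ÷ℕ d) * ℕ→ℚ d ≡ x
  ÷ℕ-*-cancel x zero    d≢0 = ⊥-elim (d≢0 refl)
  ÷ℕ-*-cancel x (suc d) _   = begin
    x * (+ 1 / suc d) * ℕ→ℚ (suc d)    ≡⟨ ℚₚ.*-assoc x _ _ ⟩
    x * ((+ 1 / suc d) * ℕ→ℚ (suc d))  ≡⟨ cong (x *_) (1/suc-*-suc d) ⟩
    x * 1ℚ                             ≡⟨ ℚₚ.*-identityʳ x ⟩
    x                                  ∎

  ÷ℕ-*-comm : ∀ x y d → (x ÷ℕ d) * y ≡ (x * y) ÷ℕ d
  ÷ℕ-*-comm x y zero    = ℚₚ.*-zeroˡ y
  ÷ℕ-*-comm x y (suc d) = solve 3 (λ x y i → (x :* i) :* y := (x :* y) :* i) refl x y (+ 1 / suc d)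

  *-÷ℕ-cancel : ∀ x d → d ≢ 0 → (x * ℕ→ℚ d) ÷ℕ d ≡ x
  *-÷ℕ-cancel x d d≢0 = begin
    (x * ℕ→ℚ d) ÷ℕ d  ≡⟨ ÷ℕ-*-comm x (ℕ→ℚ d) d ⟨
    (x ÷ℕ d) * ℕ→ℚ d  ≡⟨ ÷ℕ-*-cancel x d d≢0 ⟩
    x                 ∎

  *ℕ→ℚ-cancelʳ : ∀ x y d → d ≢ 0 → x * ℕ→ℚ d ≡ y * ℕ→ℚ d → x ≡ y
  *ℕ→ℚ-cancelʳ x y d d≢0 eq = begin
    x                 ≡⟨ *-÷ℕ-cancel x d d≢0 ⟨
    (x * ℕ→ℚ d) ÷ℕ d  ≡⟨ cong (_÷ℕ d) eq ⟩
    (y * ℕ→ℚ d) ÷ℕ d  ≡⟨ *-÷ℕ-cancel y d d≢0 ⟩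
    y                 ∎

  frac : ℕ → ℕ → ℚ
  frac n d = ℕ→ℚ n ÷ℕ d

  frac-*ʳ : ∀ n d r → frac n d * ℕ→ℚ r ≡ frac (n ℕ.* r) d
  frac-*ʳ n d r = trans (÷ℕ-*-comm (ℕ→ℚ n) (ℕ→ℚ r) d) (cong (_÷ℕ d) (sym (ℕ→ℚ-homo-* n r)))

  frac-*ˡ : ∀ c n d → ℕ→ℚ c * frac n d ≡ frac (c ℕ.* n) d
  frac-*ˡ c n d = begin
    ℕ→ℚ c * frac n d  ≡⟨ ℚₚ.*-comm (ℕ→ℚ c) _ ⟩
    frac n d * ℕ→ℚ c  ≡⟨ frac-*ʳ n d c ⟩
    frac (n ℕ.* c) d  ≡⟨ cong (λ m → frac m d) (ℕₚ.*-comm n c) ⟩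
    frac (c ℕ.* n) d  ∎

  frac-+ : ∀ n m d → frac n d + frac m d ≡ frac (n ℕ.+ m) d
  frac-+ n m zero    = ℚₚ.+-identityˡ 0ℚ
  frac-+ n m (suc d) = trans (sym (ℚₚ.*-distribʳ-+ _ (ℕ→ℚ n) (ℕ→ℚ m))) (cong (_÷ℕ suc d) (sym (ℕ→ℚ-homo-+ n m)))

  frac-cong : ∀ n₁ d₁ n₂ d₂ → d₁ ≢ 0 → d₂ ≢ 0 → n₁ ℕ.* d₂ ≡ n₂ ℕ.* d₁ → frac n₁ d₁ ≡ frac n₂ d₂
  frac-cong n₁ d₁ n₂ d₂ d₁≢0 d₂≢0 eq = *ℕ→ℚ-cancelʳ _ _ (d₁ ℕ.* d₂) (*-≢0 d₁≢0 d₂≢0) (begin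
    frac n₁ d₁ * ℕ→ℚ (d₁ ℕ.* d₂)       ≡⟨ cong (frac n₁ d₁ *_) (ℕ→ℚ-homo-* d₁ d₂) ⟩
    frac n₁ d₁ * (ℕ→ℚ d₁ * ℕ→ℚ d₂)     ≡⟨ ℚₚ.*-assoc (frac n₁ d₁) _ _ ⟨
    frac n₁ d₁ * ℕ→ℚ d₁ * ℕ→ℚ d₂       ≡⟨ cong (_* ℕ→ℚ d₂) (÷ℕ-*-cancel (ℕ→ℚ n₁) d₁ d₁≢0) ⟩
    ℕ→ℚ n₁ * ℕ→ℚ d₂                    ≡⟨ ℕ→ℚ-homo-* n₁ d₂ ⟨
    ℕ→ℚ (n₁ ℕ.* d₂)                    ≡⟨ cong ℕ→ℚ eq ⟩
    ℕ→ℚ (n₂ ℕ.* d₁)                    ≡⟨ ℕ→ℚ-homo-* n₂ d₁ ⟩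
    ℕ→ℚ n₂ * ℕ→ℚ d₁                    ≡⟨ cong (_* ℕ→ℚ d₁) (÷ℕ-*-cancel (ℕ→ℚ n₂) d₂ d₂≢0) ⟨
    frac n₂ d₂ * ℕ→ℚ d₂ * ℕ→ℚ d₁       ≡⟨ solve 3 (λ x a b → (x :* b) :* a := x :* (a :* b)) refl (frac n₂ d₂) (ℕ→ℚ d₁) (ℕ→ℚ d₂) ⟩
    frac n₂ d₂ * (ℕ→ℚ d₁ * ℕ→ℚ d₂)     ≡⟨ cong (frac n₂ d₂ *_) (ℕ→ℚ-homo-* d₁ d₂) ⟨
    frac n₂ d₂ * ℕ→ℚ (d₁ ℕ.* d₂)       ∎)

  frac-lincomb : ∀ x n y m d → ℕ→ℚ x * frac n d + ℕ→ℚ y * frac m d ≡ frac (x ℕ.* n ℕ.+ y ℕ.* m) d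
  frac-lincomb x n y m d = trans (cong₂ _+_ (frac-*ˡ x n d) (frac-*ˡ y m d)) (frac-+ (x ℕ.* n) (y ℕ.* m) d)

  frac-1-+ : ∀ x y → x ≢ 0 → y ≢ 0 → frac 1 x + frac 1 y ≡ ℕ→ℚ (x ℕ.+ y) * frac 1 (x ℕ.* y)
  frac-1-+ x y x≢0 y≢0 = begin
    frac 1 x + frac 1 y                  ≡⟨ cong₂ _+_ (frac-cong 1 x y (x ℕ.* y) x≢0 xy≢0 (trans (ℕₚ.*-identityˡ _) (ℕₚ.*-comm x y)))
                                                      (frac-cong 1 y x (x ℕ.* y) y≢0 xy≢0 (ℕₚ.*-identityˡ _)) ⟩
    frac y (x ℕ.* y) + frac x (x ℕ.* y)  ≡⟨ frac-+ y x (x ℕ.* y) ⟩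
    frac (y ℕ.+ x) (x ℕ.* y)             ≡⟨ cong (λ n → frac n (x ℕ.* y)) (trans (ℕₚ.+-comm y x) (sym (ℕₚ.*-identityʳ (x ℕ.+ y)))) ⟩
    frac ((x ℕ.+ y) ℕ.* 1) (x ℕ.* y)     ≡⟨ frac-*ˡ (x ℕ.+ y) 1 (x ℕ.* y) ⟨
    ℕ→ℚ (x ℕ.+ y) * frac 1 (x ℕ.* y)     ∎
    where xy≢0 = *-≢0 x≢0 y≢0

  ∑ : ℕ → (ℕ → ℚ) → ℚ
  ∑ n f = foldr _+_ 0ℚ (applyUpTo f n)

  ∏ : ℕ → (ℕ → ℚ) → ℚ
  ∏ n f = foldr _*_ 1ℚ (applyUpTo f n)

  Σ<≡∑ : ∀ n f → Σ< n f ≡ ∑ n f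
  Σ<≡∑ n f = cong (foldr _+_ 0ℚ) (List.map-applyUpTo (λ i → i) f n)

  Π<≡∏ : ∀ n f → Π< n f ≡ ∏ n f
  Π<≡∏ n f = cong (foldr _*_ 1ℚ) (List.map-applyUpTo (λ i → i) f n)

  ∑-last : ∀ n f → ∑ (suc n) f ≡ ∑ n f + f n
  ∑-last zero    f = trans (ℚₚ.+-identityʳ (f 0)) (sym (ℚₚ.+-identityˡ (f 0)))
  ∑-last (suc n) f = trans (cong (_+_ (f 0)) (∑-last n (λ i → f (suc i)))) (sym (ℚₚ.+-assoc (f 0) _ _))

  ∏-last : ∀ n f → ∏ (suc n) f ≡ ∏ n f * f n
  ∏-last zero    f = trans (ℚₚ.*-identityʳ (f 0)) (sym (ℚₚ.*-identityˡ (f 0)))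
  ∏-last (suc n) f = trans (cong (f 0 *_) (∏-last n (λ i → f (suc i)))) (sym (ℚₚ.*-assoc (f 0) _ _))

  ∑-cong : ∀ n {f g} → (∀ i → i < n → f i ≡ g i) → ∑ n f ≡ ∑ n g
  ∑-cong zero    f≡g = refl
  ∑-cong (suc n) f≡g = cong₂ _+_ (f≡g 0 (s≤s z≤n)) (∑-cong n (λ i i<n → f≡g (suc i) (s≤s i<n)))

  ∑-distrib-+ : ∀ n f g → ∑ n (λ i → f i + g i) ≡ ∑ n f + ∑ n g
  ∑-distrib-+ zero    f g = sym (ℚₚ.+-identityʳ 0ℚ)
  ∑-distrib-+ (suc n) f g = trans (cong (_+_ (f 0 + g 0)) (∑-distrib-+ n (λ i → f (suc i)) (λ i → g (suc i))))
    (solve 4 (λ a b c d → (a :+ b) :+ (c :+ d) := (a :+ c) :+ (b :+ d)) refl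
      (f 0) (g 0) (∑ n (λ i → f (suc i))) (∑ n (λ i → g (suc i))))

  ∑-*ˡ : ∀ n c f → ∑ n (λ i → c * f i) ≡ c * ∑ n f
  ∑-*ˡ zero    c f = sym (ℚₚ.*-zeroʳ c)
  ∑-*ˡ (suc n) c f = trans (cong (_+_ (c * f 0)) (∑-*ˡ n c (λ i → f (suc i)))) (sym (ℚₚ.*-distribˡ-+ c (f 0) _))

  ∑-telescope : ∀ n g → ∑ n (λ i → g i - g (suc i)) ≡ g 0 - g n
  ∑-telescope zero    g = sym (ℚₚ.+-inverseʳ (g 0))
  ∑-telescope (suc n) g = begin
    (g 0 - g 1) + ∑ n (λ i → g (suc i) - g (suc (suc i)))  ≡⟨ cong (_+_ (g 0 - g 1)) (∑-telescope n (λ i → g (suc i))) ⟩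
    (g 0 - g 1) + (g 1 - g (suc n))                        ≡⟨ solve 3 (λ a b c → (a :- b) :+ (b :- c) := a :- c) refl (g 0) (g 1) (g (suc n)) ⟩
    g 0 - g (suc n)                                        ∎

  ∑-reverse : ∀ n f → ∑ n f ≡ ∑ n (λ i → f (n ℕ.∸ suc i))
  ∑-reverse zero    f = refl
  ∑-reverse (suc n) f = begin
    f 0 + ∑ n (λ i → f (suc i))                   ≡⟨ cong (_+_ (f 0)) (∑-reverse n (λ i → f (suc i))) ⟩
    f 0 + ∑ n (λ i → f (suc (n ℕ.∸ suc i)))       ≡⟨ ℚₚ.+-comm (f 0) _ ⟩
    ∑ n (λ i → f (suc (n ℕ.∸ suc i))) + f 0       ≡⟨ cong₂ _+_ (∑-cong n (λ i i<n → cong f (sym (ℕₚ.+-∸-assoc 1 i<n))))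
                                                               (cong f (sym (ℕₚ.n∸n≡0 n))) ⟩
    ∑ n (λ i → f (suc n ℕ.∸ suc i)) + f (suc n ℕ.∸ suc n)  ≡⟨ ∑-last n (λ i → f (suc n ℕ.∸ suc i)) ⟨
    ∑ (suc n) (λ i → f (suc n ℕ.∸ suc i))         ∎


module Congruence (p : ℕ) (p-prime : Prime p) where

  open Rationals
  open import Data.Nat as ℕ using (ℕ; zero; suc; _<_; _!; s≤s; z≤n)
  import Data.Nat.Properties as ℕₚ
  open import Data.Nat.Divisibility using (_∣_; divides; ∣-trans; >⇒∤)
  open import Data.Nat.Primality using (prime⇒nonTrivial; euclidsLemma)
  open import Data.Nat.Coprimality using (coprime-divisor; recompute) renaming (sym to coprime-sym)
  open import Data.Integer as ℤ using (ℤ; +_)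
  import Data.Integer.Properties as ℤₚ
  open import Data.Rational using (ℚ; mkℚ; 0ℚ; 1ℚ; _+_; _*_; _-_; -_; ↥_; ↧ₙ_)
  import Data.Rational.Properties as ℚₚ
  open import Data.Rational.Solver using (module +-*-Solver)
  open import Data.Product using (_×_; _,_)
  open import Data.Sum using ([_,_]′)
  open import Data.Empty using (⊥-elim)
  open import Relation.Nullary using (¬_)
  open import Relation.Binary.PropositionalEquality
  open +-*-Solver using (solve; _:+_; _:*_; _:-_; _:=_; con)
  open ≡-Reasoning

  p∤* : ∀ {m n} → ¬ p ∣ m → ¬ p ∣ n → ¬ p ∣ m ℕ.* n
  p∤* p∤m p∤n p∣mn = [ p∤m , p∤n ]′ (euclidsLemma _ _ p-prime p∣mn)

  p∤1 : ¬ p ∣ 1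
  p∤1 = >⇒∤ (ℕ.nonTrivial⇒n>1 p {{prime⇒nonTrivial p-prime}})

  p∤! : ∀ n → n < p → ¬ p ∣ n !
  p∤! zero    _   = p∤1
  p∤! (suc n) n<p = p∤* (>⇒∤ n<p) (p∤! n (ℕₚ.<-trans (ℕₚ.n<1+n n) n<p))

  p∤⇒≢0 : ∀ {n} → ¬ p ∣ n → n ≢ 0
  p∤⇒≢0 p∤n refl = p∤n (divides 0 refl)

  record Integral (x : ℚ) : Set where
    constructor integral
    field
      numerator               : ℤ
      denominator             : ℕ
      p∤denominator           : ¬ p ∣ denominator
      x*denominator≡numerator : x * ℕ→ℚ denominator ≡ ℤ→ℚ numerator

  integral-ℤ→ℚ : ∀ a → Integral (ℤ→ℚ a)
  integral-ℤ→ℚ a = integral a 1 p∤1 (ℚₚ.*-identityʳ _)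

  integral-ℕ→ℚ : ∀ n → Integral (ℕ→ℚ n)
  integral-ℕ→ℚ n = integral-ℤ→ℚ (+ n)

  integral-+ : ∀ {x y} → Integral x → Integral y → Integral (x + y)
  integral-+ {x} {y} (integral a b p∤b xb≡a) (integral c d p∤d yd≡c) =
    integral (a ℤ.* + d ℤ.+ c ℤ.* + b) (b ℕ.* d) (p∤* p∤b p∤d) (begin
      (x + y) * ℕ→ℚ (b ℕ.* d)                          ≡⟨ cong ((x + y) *_) (ℕ→ℚ-homo-* b d) ⟩
      (x + y) * (ℕ→ℚ b * ℕ→ℚ d)                        ≡⟨ solve 4 (λ x y B D → (x :+ y) :* (B :* D) := (x :* B) :* D :+ (y :* D) :* B)
                                                                  refl x y (ℕ→ℚ b) (ℕ→ℚ d) ⟩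
      (x * ℕ→ℚ b) * ℕ→ℚ d + (y * ℕ→ℚ d) * ℕ→ℚ b        ≡⟨ cong₂ (λ u v → u * ℕ→ℚ d + v * ℕ→ℚ b) xb≡a yd≡c ⟩
      ℤ→ℚ a * ℤ→ℚ (+ d) + ℤ→ℚ c * ℤ→ℚ (+ b)            ≡⟨ cong₂ _+_ (ℤ→ℚ-homo-* a (+ d)) (ℤ→ℚ-homo-* c (+ b)) ⟨
      ℤ→ℚ (a ℤ.* + d) + ℤ→ℚ (c ℤ.* + b)                ≡⟨ ℤ→ℚ-homo-+ (a ℤ.* + d) (c ℤ.* + b) ⟨
      ℤ→ℚ (a ℤ.* + d ℤ.+ c ℤ.* + b)                    ∎)

  integral-* : ∀ {x y} → Integral x → Integral y → Integral (x * y)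
  integral-* {x} {y} (integral a b p∤b xb≡a) (integral c d p∤d yd≡c) =
    integral (a ℤ.* c) (b ℕ.* d) (p∤* p∤b p∤d) (begin
      (x * y) * ℕ→ℚ (b ℕ.* d)        ≡⟨ cong ((x * y) *_) (ℕ→ℚ-homo-* b d) ⟩
      (x * y) * (ℕ→ℚ b * ℕ→ℚ d)      ≡⟨ solve 4 (λ x y B D → (x :* y) :* (B :* D) := (x :* B) :* (y :* D)) refl x y (ℕ→ℚ b) (ℕ→ℚ d) ⟩
      (x * ℕ→ℚ b) * (y * ℕ→ℚ d)      ≡⟨ cong₂ _*_ xb≡a yd≡c ⟩
      ℤ→ℚ a * ℤ→ℚ c                  ≡⟨ ℤ→ℚ-homo-* a c ⟨
      ℤ→ℚ (a ℤ.* c)                  ∎)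

  integral-neg : ∀ {x} → Integral x → Integral (- x)
  integral-neg {x} (integral a b p∤b xb≡a) = integral (ℤ.- a) b p∤b (begin
    - x * ℕ→ℚ b    ≡⟨ ℚₚ.neg-distribˡ-* x (ℕ→ℚ b) ⟨
    - (x * ℕ→ℚ b)  ≡⟨ cong -_ xb≡a ⟩
    - ℤ→ℚ a        ≡⟨ ℤ→ℚ-homo‿- a ⟨
    ℤ→ℚ (ℤ.- a)    ∎)

  integral-÷ℕ : ∀ {x} n → ¬ p ∣ n → Integral x → Integral (x ÷ℕ n)
  integral-÷ℕ {x} n p∤n (integral a b p∤b xb≡a) = integral a (b ℕ.* n) (p∤* p∤b p∤n) (begin
    (x ÷ℕ n) * ℕ→ℚ (b ℕ.* n)       ≡⟨ cong ((x ÷ℕ n) *_) (trans (cong ℕ→ℚ (ℕₚ.*-comm b n)) (ℕ→ℚ-homo-* n b)) ⟩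
    (x ÷ℕ n) * (ℕ→ℚ n * ℕ→ℚ b)     ≡⟨ ℚₚ.*-assoc (x ÷ℕ n) _ _ ⟨
    (x ÷ℕ n) * ℕ→ℚ n * ℕ→ℚ b       ≡⟨ cong (_* ℕ→ℚ b) (÷ℕ-*-cancel x n (p∤⇒≢0 p∤n)) ⟩
    x * ℕ→ℚ b                      ≡⟨ xb≡a ⟩
    ℤ→ℚ a                          ∎)

  integral-frac : ∀ n d → ¬ p ∣ d → Integral (frac n d)
  integral-frac n d p∤d = integral-÷ℕ d p∤d (integral-ℕ→ℚ n)

  integral-∑ : ∀ n {f} → (∀ i → i < n → Integral (f i)) → Integral (∑ n f)
  integral-∑ zero    _          = integral-ℕ→ℚ 0
  integral-∑ (suc n) f-integral =
    integral-+ (f-integral 0 (s≤s z≤n)) (integral-∑ n (λ i i<n → f-integral (suc i) (s≤s i<n)))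

  infix 4 _≈_

  record _≈_ (x y : ℚ) : Set where
    constructor congruent
    field
      quotient          : ℚ
      quotient-integral : Integral quotient
      x-y≡p*quotient    : x - y ≡ ℕ→ℚ p * quotient

  ≈-reflexive : ∀ {x y} → x ≡ y → x ≈ y
  ≈-reflexive {x} refl = congruent 0ℚ (integral-ℕ→ℚ 0) (trans (ℚₚ.+-inverseʳ x) (sym (ℚₚ.*-zeroʳ (ℕ→ℚ p))))

  ≈-trans : ∀ {x y w} → x ≈ y → y ≈ w → x ≈ w
  ≈-trans {x} {y} {w} (congruent z z-integral x-y≡pz) (congruent z′ z′-integral y-w≡pz′) =
    congruent (z + z′) (integral-+ z-integral z′-integral) (begin
      x - w              ≡⟨ solve 3 (λ x y w → x :- w := (x :- y) :+ (y :- w)) refl x y w ⟩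
      (x - y) + (y - w)  ≡⟨ cong₂ _+_ x-y≡pz y-w≡pz′ ⟩
      P * z + P * z′     ≡⟨ ℚₚ.*-distribˡ-+ P z z′ ⟨
      P * (z + z′)       ∎)
    where P = ℕ→ℚ p

  ≈-+ : ∀ {x y u v} → x ≈ y → u ≈ v → x + u ≈ y + v
  ≈-+ {x} {y} {u} {v} (congruent z z-integral x-y≡pz) (congruent z′ z′-integral u-v≡pz′) =
    congruent (z + z′) (integral-+ z-integral z′-integral) (begin
      (x + u) - (y + v)  ≡⟨ solve 4 (λ x y u v → (x :+ u) :- (y :+ v) := (x :- y) :+ (u :- v)) refl x y u v ⟩
      (x - y) + (u - v)  ≡⟨ cong₂ _+_ x-y≡pz u-v≡pz′ ⟩
      P * z + P * z′     ≡⟨ ℚₚ.*-distribˡ-+ P z z′ ⟨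
      P * (z + z′)       ∎)
    where P = ℕ→ℚ p

  ≈-*ˡ : ∀ {c x y} → Integral c → x ≈ y → c * x ≈ c * y
  ≈-*ˡ {c} {x} {y} c-integral (congruent z z-integral x-y≡pz) = congruent (c * z) (integral-* c-integral z-integral) (begin
    c * x - c * y  ≡⟨ solve 3 (λ c x y → c :* x :- c :* y := c :* (x :- y)) refl c x y ⟩
    c * (x - y)    ≡⟨ cong (c *_) x-y≡pz ⟩
    c * (P * z)    ≡⟨ solve 3 (λ c P z → c :* (P :* z) := P :* (c :* z)) refl c P z ⟩
    P * (c * z)    ∎)
    where P = ℕ→ℚ p

  p∣↥∧p∤↧ : ∀ w b m → ¬ p ∣ b → ℤ.∣ ↥ w ∣ ℕ.* b ≡ p ℕ.* m ℕ.* ↧ₙ w → p ∣ ℤ.∣ ↥ w ∣ × ¬ p ∣ ↧ₙ w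
  p∣↥∧p∤↧ (mkℚ n d coprime) b m p∤b nb≡pmd = p∣n , p∤d
    where
    p∣n : p ∣ ℤ.∣ n ∣
    p∣n = [ (λ p∣n → p∣n) , (λ p∣b → ⊥-elim (p∤b p∣b)) ]′
      (euclidsLemma _ b p-prime (divides (m ℕ.* suc d) (trans nb≡pmd (trans (ℕₚ.*-assoc p m _) (ℕₚ.*-comm p _)))))
    p∤d : ¬ p ∣ suc d
    p∤d p∣d = p∤b (∣-trans p∣d (coprime-divisor (coprime-sym (recompute coprime)) (divides (p ℕ.* m) nb≡pmd)))

  ≈⇒≡[modℚ] : ∀ {x y} → x ≈ y → x ≡ y [modℚ p ]
  ≈⇒≡[modℚ] {x} {y} (congruent z (integral a b p∤b zb≡a) x-y≡pz) =
    p∣↥∧p∤↧ (x - y) b ℤ.∣ a ∣ p∤b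
      (trans (∣↥∣-cross-multiply (x - y) b (+ p ℤ.* a) x-y*b≡pa) (cong (ℕ._* ↧ₙ (x - y)) (ℤₚ.abs-* (+ p) a)))
    where
    x-y*b≡pa : (x - y) * ℕ→ℚ b ≡ ℤ→ℚ (+ p ℤ.* a)
    x-y*b≡pa = begin
      (x - y) * ℕ→ℚ b      ≡⟨ cong (_* ℕ→ℚ b) x-y≡pz ⟩
      ℕ→ℚ p * z * ℕ→ℚ b    ≡⟨ ℚₚ.*-assoc (ℕ→ℚ p) z _ ⟩
      ℕ→ℚ p * (z * ℕ→ℚ b)  ≡⟨ cong (ℕ→ℚ p *_) zb≡a ⟩
      ℕ→ℚ p * ℤ→ℚ a        ≡⟨ ℤ→ℚ-homo-* (+ p) a ⟨
      ℤ→ℚ (+ p ℤ.* a)      ∎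

  harmonic≈0 : ¬ p ∣ 2 → ∀ n → suc n ≡ p → ∑ n (λ j → frac 1 (suc j)) ≈ 0ℚ
  harmonic≈0 p∤2 n 1+n≡p = congruent (Z ÷ℕ 2) (integral-÷ℕ 2 p∤2 Z-integral) (begin
    H - 0ℚ            ≡⟨ ℚₚ.+-identityʳ H ⟩
    H                 ≡⟨ *ℕ→ℚ-cancelʳ H _ 2 (λ ()) H*2≡pZ ⟩
    P * (Z ÷ℕ 2)      ∎)
    where
    P = ℕ→ℚ p
    h : ℕ → ℚ
    h j = frac 1 (suc j)
    H = ∑ n h
    partner : ℕ → ℕ
    partner i = suc (n ℕ.∸ suc i)
    z : ℕ → ℚ
    z i = frac 1 (suc i ℕ.* partner i)
    Z = ∑ n z
    partner<p : ∀ i → i < n → partner i < p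
    partner<p i i<n = subst (partner i <_) 1+n≡p (s≤s (subst (ℕ._≤ n) (ℕₚ.+-∸-assoc 1 i<n) (ℕₚ.m∸n≤m n i)))
    i+partner≡p : ∀ i → i < n → suc i ℕ.+ partner i ≡ p
    i+partner≡p i i<n = trans (ℕₚ.+-suc (suc i) _) (trans (cong suc (ℕₚ.m+[n∸m]≡n i<n)) 1+n≡p)
    Z-integral : Integral Z
    Z-integral = integral-∑ n (λ i i<n → integral-frac 1 _
      (p∤* (>⇒∤ (subst (suc i <_) 1+n≡p (s≤s i<n))) (>⇒∤ (partner<p i i<n))))
    pair : ∀ i → i < n → h i + h (n ℕ.∸ suc i) ≡ P * z i
    pair i i<n = trans (frac-1-+ (suc i) (partner i) (λ ()) (λ ())) (cong (λ m → ℕ→ℚ m * z i) (i+partner≡p i i<n))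
    H*2≡pZ : H * ℕ→ℚ 2 ≡ P * (Z ÷ℕ 2) * ℕ→ℚ 2
    H*2≡pZ = begin
      H * ℕ→ℚ 2                              ≡⟨ solve 1 (λ x → x :* (con 1ℚ :+ con 1ℚ) := x :+ x) refl H ⟩
      H + H                                  ≡⟨ cong (_+_ H) (∑-reverse n h) ⟩
      H + ∑ n (λ i → h (n ℕ.∸ suc i))        ≡⟨ ∑-distrib-+ n h _ ⟨
      ∑ n (λ i → h i + h (n ℕ.∸ suc i))      ≡⟨ ∑-cong n pair ⟩
      ∑ n (λ i → P * z i)                    ≡⟨ ∑-*ˡ n P z ⟩
      P * Z                                  ≡⟨ cong (P *_) (÷ℕ-*-cancel Z 2 (λ ())) ⟨
      P * (Z ÷ℕ 2 * ℕ→ℚ 2)                   ≡⟨ ℚₚ.*-assoc P _ _ ⟨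
      P * (Z ÷ℕ 2) * ℕ→ℚ 2                   ∎

module Coefficients where

  open import Data.Nat
  open import Data.Nat.Properties
  open import Data.Nat.Combinatorics using (_C_; nCk≡n!/k![n-k]!; k![n∸k]!∣n!)
  open import Data.Nat.DivMod using (m/n*n≡m)
  open import Data.Nat.Tactic.RingSolver using (solve-∀)
  open import Relation.Binary.PropositionalEquality
  open ≡-Reasoning

  n!≢0 : ∀ n → n ! ≢ 0
  n!≢0 n = ≢-nonZero⁻¹ (n !) {{_!≢0 n}}

  C*!*!≡! : ∀ m j → ((m + j) C m) * (m ! * j !) ≡ (m + j) !
  C*!*!≡! m j = begin
    ((m + j) C m) * (m ! * j !)            ≡⟨ cong (λ i → ((m + j) C m) * (m ! * i !)) (m+n∸m≡n m j) ⟨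
    ((m + j) C m) * (m ! * (m + j ∸ m) !)  ≡⟨ cong (_* (m ! * (m + j ∸ m) !)) (nCk≡n!/k![n-k]! (m≤m+n m j)) ⟩
    ((m + j) ! / (m ! * (m + j ∸ m) !)) {{m !* (m + j ∸ m) !≢0}} * (m ! * (m + j ∸ m) !)
                                           ≡⟨ m/n*n≡m {{m !* (m + j ∸ m) !≢0}} (k![n∸k]!∣n! (m≤m+n m j)) ⟩
    (m + j) !                              ∎

  C≢0 : ∀ m j → (m + j) C m ≢ 0
  C≢0 m j C≡0 = n!≢0 (m + j) (trans (sym (C*!*!≡! m j)) (cong (_* (m ! * j !)) C≡0))

  rising : ℕ → ℕ → ℕ
  rising k zero    = 1
  rising k (suc m) = rising k m * (k + m)

  rising-*-! : ∀ a m → rising (suc a) m * a ! ≡ (a + m) !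
  rising-*-! a zero    = trans (*-identityˡ (a !)) (cong _! (sym (+-identityʳ a)))
  rising-*-! a (suc m) = begin
    rising (suc a) m * suc (a + m) * a !    ≡⟨ rearrange (rising (suc a) m) (suc (a + m)) (a !) ⟩
    suc (a + m) * (rising (suc a) m * a !)  ≡⟨ cong (suc (a + m) *_) (rising-*-! a m) ⟩
    suc (a + m) !                           ≡⟨ cong _! (+-suc a m) ⟨
    (a + suc m) !                           ∎
    where
    rearrange : ∀ r s f → r * s * f ≡ s * (r * f)
    rearrange = solve-∀

  numer denom : ℕ → ℕ → ℕ
  numer a j = suc (a + a + j) ! * j !
  denom a j = suc (a + j) ! * suc (a + j) !

  c M : ℕ → ℕ → ℕ
  c a j = 2 + (a + a + j)
  M a j = (2 + (a + j)) * (2 + (a + j))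

  c-zero : ∀ a → c a 0 ≡ 2 * suc a
  c-zero a = polynomial a
    where
    polynomial : ∀ a → 2 + (a + a + 0) ≡ 2 * suc a
    polynomial = solve-∀

  denom≢0 : ∀ a j → denom a j ≢ 0
  denom≢0 a j = ≢-nonZero⁻¹ (denom a j) {{m*n≢0 _ _ {{_!≢0 (suc (a + j))}} {{_!≢0 (suc (a + j))}}}}

  numer-suc-j : ∀ a j → numer a (suc j) ≡ c a j * suc j * numer a j
  numer-suc-j a j rewrite +-suc (a + a) j = polynomial (a + a + j) (suc (a + a + j) !) j (j !)
    where
    polynomial : ∀ x f y g → (2 + x) * f * (suc y * g) ≡ (2 + x) * suc y * (f * g)
    polynomial = solve-∀

  denom-suc-j : ∀ a j → denom a (suc j) ≡ M a j * denom a j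
  denom-suc-j a j rewrite +-suc a j = polynomial (a + j) (suc (a + j) !)
    where
    polynomial : ∀ x f → (2 + x) * f * ((2 + x) * f) ≡ (2 + x) * (2 + x) * (f * f)
    polynomial = solve-∀

  numer-suc-a : ∀ a j → numer (suc a) j ≡ suc (c a j) * c a j * numer a j
  numer-suc-a a j rewrite +-suc a a = polynomial (a + a + j) (suc (a + a + j) !) (j !)
    where
    polynomial : ∀ x f g → (3 + x) * ((2 + x) * f) * g ≡ (3 + x) * (2 + x) * (f * g)
    polynomial = solve-∀

  denom-suc-a : ∀ a j → denom (suc a) j ≡ denom a (suc j)
  denom-suc-a a j rewrite +-suc a j = refl

  numer-recurrence : ∀ a j →
    suc a * numer (suc a) j + 2 * (c a (suc j) * numer a (suc j))
      ≡ suc a * numer a (suc j) + 2 * (c a j * (numer a j * M a j))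
  numer-recurrence a j rewrite numer-suc-a a j | numer-suc-j a j = polynomial a j (numer a j)
    where
    polynomial : ∀ a j n →
      suc a * ((3 + (a + a + j)) * (2 + (a + a + j)) * n) + 2 * ((2 + (a + a + suc j)) * ((2 + (a + a + j)) * suc j * n))
        ≡ suc a * ((2 + (a + a + j)) * suc j * n) + 2 * ((2 + (a + a + j)) * (n * ((2 + (a + j)) * (2 + (a + j)))))
    polynomial = solve-∀

  boundary-numerator : ∀ a L →
    suc a * numer a (suc L) + 2 * (c a L * (numer a L * M a L))
      ≡ (3 + a + a + L) * (numer a L * c a L * (3 + a + (L + L)))
  boundary-numerator a L rewrite numer-suc-j a L = polynomial a L (numer a L)
    where
    polynomial : ∀ a L n →
      suc a * ((2 + (a + a + L)) * suc L * n) + 2 * ((2 + (a + a + L)) * (n * ((2 + (a + L)) * (2 + (a + L)))))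
        ≡ (3 + a + a + L) * (n * (2 + (a + a + L)) * (3 + a + (L + L)))
    polynomial = solve-∀

  numer-zero : ∀ j → numer 0 j * suc j ≡ 1 * denom 0 j
  numer-zero j = polynomial j (j !)
    where
    polynomial : ∀ j g → suc j * g * g * suc j ≡ 1 * (suc j * g * (suc j * g))
    polynomial = solve-∀

  numer-*-2k : ∀ a → numer a 0 * (2 * suc a) * 1 ≡ ((2 * suc a) C suc a) * denom a 0
  numer-*-2k a = begin
    numer a 0 * (2 * suc a) * 1                          ≡⟨ polynomial a (suc (a + a + 0) !) ⟩
    suc (suc (a + a + 0)) !                              ≡⟨ cong _! (double a) ⟩
    (suc a + suc a) !                                    ≡⟨ C*!*!≡! (suc a) (suc a) ⟨
    ((suc a + suc a) C suc a) * (suc a ! * suc a !)      ≡⟨ cong₂ (λ m i → (m C suc a) * (suc i ! * suc i !)) (twice a) (+-identityʳ a) ⟨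
    ((2 * suc a) C suc a) * denom a 0                    ∎
    where
    polynomial : ∀ a f → f * 1 * (2 * suc a) * 1 ≡ suc (suc (a + a + 0)) * f
    polynomial = solve-∀
    double : ∀ a → suc (suc (a + a + 0)) ≡ suc a + suc a
    double = solve-∀
    twice : ∀ a → 2 * suc a ≡ suc a + suc a
    twice = solve-∀

  rising-*-denom : ∀ a j → let k = suc a ; m = suc a + j in
    rising k m * denom a j ≡ k * numer a j * (m C k) * m !
  rising-*-denom a j = *-cancelʳ-≡ _ _ (a !) {{_!≢0 a}} (begin
    rising k m * denom a j * a !                          ≡⟨ swap (rising k m) (denom a j) (a !) ⟩
    rising k m * a ! * denom a j                          ≡⟨ cong (_* denom a j) (rising-*-! a m) ⟩
    (a + m) ! * denom a j                                 ≡⟨ cong (λ i → i ! * denom a j) (a+m≡ a j) ⟩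
    suc (a + a + j) ! * (m ! * m !)                       ≡⟨ cong (λ x → suc (a + a + j) ! * (m ! * x)) (C*!*!≡! k j) ⟨
    suc (a + a + j) ! * (m ! * ((m C k) * (k ! * j !)))   ≡⟨ polynomial a (suc (a + a + j) !) (j !) (m C k) (a !) (m !) ⟩
    k * numer a j * (m C k) * m ! * a !                   ∎)
    where
    k = suc a
    m = suc a + j
    swap : ∀ r d f → r * d * f ≡ r * f * d
    swap = solve-∀
    a+m≡ : ∀ a j → a + suc (a + j) ≡ suc (a + a + j)
    a+m≡ = solve-∀
    polynomial : ∀ a F g b f m → F * (m * (b * (suc a * f * g))) ≡ suc a * (F * g) * b * m * f
    polynomial = solve-∀


module Summand where

  open Rationals
  open Coefficients
  open import Data.Nat as ℕ using (ℕ; zero; suc; _!)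
  import Data.Nat.Properties as ℕₚ
  open import Data.Nat.Combinatorics using (_C_)
  open import Data.Integer as ℤ using (+_)
  open import Data.Rational using (ℚ; 0ℚ; 1ℚ; _+_; _*_; _-_; -_)
  import Data.Rational.Properties as ℚₚ
  open import Data.Rational.Solver using (module +-*-Solver)
  open import Relation.Binary.PropositionalEquality
  open +-*-Solver using (solve; _:+_; _:*_; _:-_; :-_; _:=_; con)
  open ≡-Reasoning

  ∏-neg-*-sgn : ∀ k m → ∏ m (λ i → ℤ→ℚ (ℤ.- (+ k) ℤ.- + i)) * sgn m ≡ ℕ→ℚ (rising k m)
  ∏-neg-*-sgn k zero    = ℚₚ.*-identityˡ 1ℚ
  ∏-neg-*-sgn k (suc m) = begin
    ∏ (suc m) f * - sgn m             ≡⟨ cong (_* - sgn m) (∏-last m f) ⟩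
    ∏ m f * f m * - sgn m             ≡⟨ solve 3 (λ x y s → (x :* y) :* (:- s) := (x :* s) :* (:- y)) refl (∏ m f) (f m) (sgn m) ⟩
    ∏ m f * sgn m * - f m             ≡⟨ cong₂ _*_ (∏-neg-*-sgn k m) -f≡k+m ⟩
    ℕ→ℚ (rising k m) * ℕ→ℚ (k ℕ.+ m)  ≡⟨ ℕ→ℚ-homo-* (rising k m) (k ℕ.+ m) ⟨
    ℕ→ℚ (rising k (suc m))            ∎
    where
    f : ℕ → ℚ
    f i = ℤ→ℚ (ℤ.- (+ k) ℤ.- + i)
    -f≡k+m : - f m ≡ ℕ→ℚ (k ℕ.+ m)
    -f≡k+m = begin
      - ℤ→ℚ (ℤ.- (+ k) ℤ.+ ℤ.- (+ m))  ≡⟨ cong -_ (trans (ℤ→ℚ-homo-+ (ℤ.- (+ k)) (ℤ.- (+ m))) (cong₂ _+_ (ℤ→ℚ-homo‿- (+ k)) (ℤ→ℚ-homo‿- (+ m)))) ⟩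
      - (- ℕ→ℚ k + - ℕ→ℚ m)            ≡⟨ solve 2 (λ x y → :- (:- x :+ :- y) := x :+ y) refl (ℕ→ℚ k) (ℕ→ℚ m) ⟩
      ℕ→ℚ k + ℕ→ℚ m                    ≡⟨ ℕ→ℚ-homo-+ k m ⟨
      ℕ→ℚ (k ℕ.+ m)                    ∎

  gbinom-neg-*-sgn : ∀ k m → gbinom (ℤ.- (+ k)) m * sgn m ≡ frac (rising k m) (m !)
  gbinom-neg-*-sgn k m = begin
    (Π< m f ÷ℕ (m !)) * sgn m  ≡⟨ ÷ℕ-*-comm (Π< m f) (sgn m) (m !) ⟩
    (Π< m f * sgn m) ÷ℕ (m !)  ≡⟨ cong (λ x → (x * sgn m) ÷ℕ (m !)) (Π<≡∏ m f) ⟩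
    (∏ m f * sgn m) ÷ℕ (m !)   ≡⟨ cong (_÷ℕ (m !)) (∏-neg-*-sgn k m) ⟩
    frac (rising k m) (m !)    ∎
    where
    f : ℕ → ℚ
    f i = ℤ→ℚ (ℤ.- (+ k) ℤ.- + i)

  u : ℕ → ℕ → ℚ
  u a j = frac (numer a j) (denom a j)

  summand : ℕ → ℕ → ℚ
  summand k j = (gbinom (ℤ.- (+ k)) (k ℕ.+ j) * sgn (k ℕ.+ j)) ÷ℕ ((k ℕ.+ j) C k)

  summand≡k*u : ∀ a j → summand (suc a) j ≡ ℕ→ℚ (suc a) * u a j
  summand≡k*u a j = *ℕ→ℚ-cancelʳ _ _ binom (C≢0 k j) (begin
    (gbinom (ℤ.- (+ k)) m * sgn m) ÷ℕ binom * ℕ→ℚ binom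
      ≡⟨ ÷ℕ-*-cancel _ binom (C≢0 k j) ⟩
    gbinom (ℤ.- (+ k)) m * sgn m
      ≡⟨ gbinom-neg-*-sgn k m ⟩
    frac (rising k m) (m !)
      ≡⟨ frac-cong (rising k m) (m !) (k ℕ.* numer a j ℕ.* binom) (denom a j) (n!≢0 m) (denom≢0 a j) (rising-*-denom a j) ⟩
    frac (k ℕ.* numer a j ℕ.* binom) (denom a j)
      ≡⟨ frac-*ʳ (k ℕ.* numer a j) (denom a j) binom ⟨
    frac (k ℕ.* numer a j) (denom a j) * ℕ→ℚ binom
      ≡⟨ cong (_* ℕ→ℚ binom) (frac-*ˡ k (numer a j) (denom a j)) ⟨
    ℕ→ℚ k * u a j * ℕ→ℚ binom
      ∎)
    where
    k = suc a
    m = k ℕ.+ j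
    binom = m C k

  v : ℕ → ℕ → ℚ
  v a j = ℕ→ℚ (c a j) * u a j

  v≡frac : ∀ a j → v a j ≡ frac (c a j ℕ.* (numer a j ℕ.* M a j)) (denom a (suc j))
  v≡frac a j = trans (cong (ℕ→ℚ (c a j) *_) u≡frac) (frac-*ˡ (c a j) (numer a j ℕ.* M a j) (denom a (suc j)))
    where
    u≡frac : u a j ≡ frac (numer a j ℕ.* M a j) (denom a (suc j))
    u≡frac = frac-cong (numer a j) (denom a j) (numer a j ℕ.* M a j) (denom a (suc j)) (denom≢0 a j) (denom≢0 a (suc j)) (begin
      numer a j ℕ.* denom a (suc j)        ≡⟨ cong (numer a j ℕ.*_) (denom-suc-j a j) ⟩
      numer a j ℕ.* (M a j ℕ.* denom a j)  ≡⟨ ℕₚ.*-assoc (numer a j) _ _ ⟨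
      numer a j ℕ.* M a j ℕ.* denom a j    ∎)

  u-recurrence : ∀ a j →
    ℕ→ℚ (suc a) * u (suc a) j + ℕ→ℚ 2 * v a (suc j) ≡ ℕ→ℚ (suc a) * u a (suc j) + ℕ→ℚ 2 * v a j
  u-recurrence a j = begin
    ℕ→ℚ k * u (suc a) j + ℕ→ℚ 2 * v a (suc j)
      ≡⟨ cong₂ (λ x y → ℕ→ℚ k * x + ℕ→ℚ 2 * y) (cong (frac (numer (suc a) j)) (denom-suc-a a j)) (frac-*ˡ (c a (suc j)) (numer a (suc j)) D) ⟩
    ℕ→ℚ k * frac (numer (suc a) j) D + ℕ→ℚ 2 * frac (c a (suc j) ℕ.* numer a (suc j)) D
      ≡⟨ frac-lincomb k (numer (suc a) j) 2 (c a (suc j) ℕ.* numer a (suc j)) D ⟩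
    frac (k ℕ.* numer (suc a) j ℕ.+ 2 ℕ.* (c a (suc j) ℕ.* numer a (suc j))) D
      ≡⟨ cong (λ n → frac n D) (numer-recurrence a j) ⟩
    frac (k ℕ.* numer a (suc j) ℕ.+ 2 ℕ.* (c a j ℕ.* (numer a j ℕ.* M a j))) D
      ≡⟨ frac-lincomb k (numer a (suc j)) 2 (c a j ℕ.* (numer a j ℕ.* M a j)) D ⟨
    ℕ→ℚ k * u a (suc j) + ℕ→ℚ 2 * frac (c a j ℕ.* (numer a j ℕ.* M a j)) D
      ≡⟨ cong (λ y → ℕ→ℚ k * u a (suc j) + ℕ→ℚ 2 * y) (v≡frac a j) ⟨
    ℕ→ℚ k * u a (suc j) + ℕ→ℚ 2 * v a j
      ∎
    where
    k = suc a
    D = denom a (suc j)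

  w : ℕ → ℕ → ℚ
  w a L = frac (numer a L ℕ.* c a L ℕ.* (3 ℕ.+ a ℕ.+ (L ℕ.+ L))) (denom a (suc L))

  -- In the induction step 3 + 2a + L = p, so this is the boundary term that vanishes mod p.
  boundary-identity : ∀ a L → ℕ→ℚ (suc a) * u a (suc L) + ℕ→ℚ 2 * v a L ≡ ℕ→ℚ (3 ℕ.+ a ℕ.+ a ℕ.+ L) * w a L
  boundary-identity a L = begin
    ℕ→ℚ k * u a (suc L) + ℕ→ℚ 2 * v a L
      ≡⟨ cong (λ y → ℕ→ℚ k * u a (suc L) + ℕ→ℚ 2 * y) (v≡frac a L) ⟩
    ℕ→ℚ k * u a (suc L) + ℕ→ℚ 2 * frac (c a L ℕ.* (numer a L ℕ.* M a L)) D
      ≡⟨ frac-lincomb k (numer a (suc L)) 2 (c a L ℕ.* (numer a L ℕ.* M a L)) D ⟩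
    frac (k ℕ.* numer a (suc L) ℕ.+ 2 ℕ.* (c a L ℕ.* (numer a L ℕ.* M a L))) D
      ≡⟨ cong (λ n → frac n D) (boundary-numerator a L) ⟩
    frac ((3 ℕ.+ a ℕ.+ a ℕ.+ L) ℕ.* (numer a L ℕ.* c a L ℕ.* (3 ℕ.+ a ℕ.+ (L ℕ.+ L)))) D
      ≡⟨ frac-*ˡ (3 ℕ.+ a ℕ.+ a ℕ.+ L) (numer a L ℕ.* c a L ℕ.* (3 ℕ.+ a ℕ.+ (L ℕ.+ L))) D ⟨
    ℕ→ℚ (3 ℕ.+ a ℕ.+ a ℕ.+ L) * w a L
      ∎
    where
    k = suc a
    D = denom a (suc L)

  σ : ℕ → ℕ → ℚ
  σ a n = ∑ n (u a)

  v-zero : ∀ a → v a 0 ≡ ℕ→ℚ 2 * ℕ→ℚ (suc a) * u a 0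
  v-zero a = cong (_* u a 0) (trans (cong ℕ→ℚ (c-zero a)) (ℕ→ℚ-homo-* 2 (suc a)))

  σ-succ-a : ∀ a L → ℕ→ℚ (suc a) * σ (suc a) L ≡ ℕ→ℚ (suc a) * (σ a (suc L) + ℕ→ℚ 3 * u a 0) - ℕ→ℚ 2 * v a L
  σ-succ-a a L = begin
    K * σ (suc a) L
      ≡⟨ ∑-*ˡ L K (u (suc a)) ⟨
    ∑ L (λ j → K * u (suc a) j)
      ≡⟨ ∑-cong L (λ j _ → shifted j) ⟩
    ∑ L (λ j → K * u a (suc j) + ℕ→ℚ 2 * (v a j - v a (suc j)))
      ≡⟨ ∑-distrib-+ L _ _ ⟩
    ∑ L (λ j → K * u a (suc j)) + ∑ L (λ j → ℕ→ℚ 2 * (v a j - v a (suc j)))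
      ≡⟨ cong₂ _+_ (∑-*ˡ L K _) (trans (∑-*ˡ L (ℕ→ℚ 2) _) (cong (ℕ→ℚ 2 *_) (∑-telescope L (v a)))) ⟩
    K * s + ℕ→ℚ 2 * (v a 0 - v a L)
      ≡⟨ cong (λ x → K * s + ℕ→ℚ 2 * (x - v a L)) (v-zero a) ⟩
    K * s + ℕ→ℚ 2 * (ℕ→ℚ 2 * K * u a 0 - v a L)
      ≡⟨ solve 4 (λ K s u₀ v → K :* s :+ con (ℕ→ℚ 2) :* (con (ℕ→ℚ 2) :* K :* u₀ :- v)
                               := K :* ((u₀ :+ s) :+ con (ℕ→ℚ 3) :* u₀) :- con (ℕ→ℚ 2) :* v) refl K s (u a 0) (v a L) ⟩
    K * (σ a (suc L) + ℕ→ℚ 3 * u a 0) - ℕ→ℚ 2 * v a L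
      ∎
    where
    K = ℕ→ℚ (suc a)
    s = ∑ L (λ j → u a (suc j))
    shifted : ∀ j → K * u (suc a) j ≡ K * u a (suc j) + ℕ→ℚ 2 * (v a j - v a (suc j))
    shifted j = begin
      K * u (suc a) j
        ≡⟨ solve 3 (λ x t y → x := (x :+ t :* y) :- t :* y) refl (K * u (suc a) j) (ℕ→ℚ 2) (v a (suc j)) ⟩
      (K * u (suc a) j + ℕ→ℚ 2 * v a (suc j)) - ℕ→ℚ 2 * v a (suc j)
        ≡⟨ cong (_- ℕ→ℚ 2 * v a (suc j)) (u-recurrence a j) ⟩
      (K * u a (suc j) + ℕ→ℚ 2 * v a j) - ℕ→ℚ 2 * v a (suc j)
        ≡⟨ solve 4 (λ z t y y′ → (z :+ t :* y) :- t :* y′ := z :+ t :* (y :- y′)) refl (K * u a (suc j)) (ℕ→ℚ 2) (v a j) (v a (suc j)) ⟩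
      K * u a (suc j) + ℕ→ℚ 2 * (v a j - v a (suc j))
        ∎

  σ-step : ∀ a L → σ (suc a) L - (σ a (2 ℕ.+ L) + ℕ→ℚ 3 * u a 0) ≡ ℕ→ℚ (3 ℕ.+ a ℕ.+ a ℕ.+ L) * - (w a L ÷ℕ suc a)
  σ-step a L = *ℕ→ℚ-cancelʳ _ _ (suc a) (λ ()) (begin
    (σ (suc a) L - (σ a (2 ℕ.+ L) + ℕ→ℚ 3 * u a 0)) * K
      ≡⟨ solve 4 (λ X Y u₀ K → (X :- (Y :+ con (ℕ→ℚ 3) :* u₀)) :* K := K :* X :- K :* (Y :+ con (ℕ→ℚ 3) :* u₀))
               refl (σ (suc a) L) (σ a (2 ℕ.+ L)) (u a 0) K ⟩
    K * σ (suc a) L - K * (σ a (2 ℕ.+ L) + ℕ→ℚ 3 * u a 0)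
      ≡⟨ cong₂ (λ x y → x - K * (y + ℕ→ℚ 3 * u a 0)) (σ-succ-a a L) (∑-last (suc L) (u a)) ⟩
    (K * (σ a (suc L) + ℕ→ℚ 3 * u a 0) - ℕ→ℚ 2 * v a L) - K * ((σ a (suc L) + u a (suc L)) + ℕ→ℚ 3 * u a 0)
      ≡⟨ solve 5 (λ K s u₀ x y → (K :* (s :+ con (ℕ→ℚ 3) :* u₀) :- con (ℕ→ℚ 2) :* y) :- K :* ((s :+ x) :+ con (ℕ→ℚ 3) :* u₀)
                                 := :- (K :* x :+ con (ℕ→ℚ 2) :* y))
               refl K (σ a (suc L)) (u a 0) (u a (suc L)) (v a L) ⟩
    - (K * u a (suc L) + ℕ→ℚ 2 * v a L)
      ≡⟨ cong -_ (boundary-identity a L) ⟩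
    - (P * w a L)
      ≡⟨ cong (λ x → - (P * x)) (÷ℕ-*-cancel (w a L) (suc a) (λ ())) ⟨
    - (P * ((w a L ÷ℕ suc a) * K))
      ≡⟨ solve 3 (λ P x K → :- (P :* (x :* K)) := (P :* (:- x)) :* K) refl P (w a L ÷ℕ suc a) K ⟩
    P * - (w a L ÷ℕ suc a) * K
      ∎)
    where
    K = ℕ→ℚ (suc a)
    P = ℕ→ℚ (3 ℕ.+ a ℕ.+ a ℕ.+ L)

  u-zero : ∀ j → u 0 j ≡ frac 1 (suc j)
  u-zero j = frac-cong (numer 0 j) (denom 0 j) 1 (suc j) (denom≢0 0 j) (λ ()) (numer-zero j)

  u-*-2k : ∀ a → u a 0 * ℕ→ℚ (2 ℕ.* suc a) ≡ ℕ→ℚ ((2 ℕ.* suc a) C suc a)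
  u-*-2k a = begin
    u a 0 * ℕ→ℚ (2 ℕ.* k)
      ≡⟨ frac-*ʳ (numer a 0) (denom a 0) (2 ℕ.* k) ⟩
    frac (numer a 0 ℕ.* (2 ℕ.* k)) (denom a 0)
      ≡⟨ frac-cong (numer a 0 ℕ.* (2 ℕ.* k)) (denom a 0) ((2 ℕ.* k) C k) 1 (denom≢0 a 0) (λ ()) (numer-*-2k a) ⟩
    ℕ→ℚ ((2 ℕ.* k) C k) * 1ℚ
      ≡⟨ ℚₚ.*-identityʳ _ ⟩
    ℕ→ℚ ((2 ℕ.* k) C k)
      ∎
    where
    k = suc a

  binom2k/k : ℕ → ℚ
  binom2k/k k = ℕ→ℚ ((2 ℕ.* k) C k) ÷ℕ k

  3/2 : ℚ
  3/2 = ℕ→ℚ 3 ÷ℕ 2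

  target : ℕ → ℚ
  target k = 3/2 * (∑ k (λ i → binom2k/k (i ℕ.+ 1)) - binom2k/k k)

  target-one : target 1 ≡ 0ℚ
  target-one = refl

  target-suc : ∀ k → target (suc k) ≡ target k + 3/2 * binom2k/k k
  target-suc k = begin
    3/2 * (∑ (suc k) b - binom2k/k (suc k))
      ≡⟨ cong (λ x → 3/2 * (x - binom2k/k (suc k))) (∑-last k b) ⟩
    3/2 * ((∑ k b + binom2k/k (k ℕ.+ 1)) - binom2k/k (suc k))
      ≡⟨ cong (λ i → 3/2 * ((∑ k b + binom2k/k i) - binom2k/k (suc k))) (ℕₚ.+-comm k 1) ⟩
    3/2 * ((∑ k b + binom2k/k (suc k)) - binom2k/k (suc k))
      ≡⟨ solve 4 (λ h s x y → h :* ((s :+ x) :- x) := h :* (s :- y) :+ h :* y) refl 3/2 (∑ k b) (binom2k/k (suc k)) (binom2k/k k) ⟩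
    3/2 * (∑ k b - binom2k/k k) + 3/2 * binom2k/k k
      ∎
    where
    b : ℕ → ℚ
    b i = binom2k/k (i ℕ.+ 1)

  3u≡3/2*binom2k/k : ∀ a → ℕ→ℚ 3 * u a 0 ≡ 3/2 * binom2k/k (suc a)
  3u≡3/2*binom2k/k a = *ℕ→ℚ-cancelʳ _ _ (2 ℕ.* k) (λ ()) (begin
    ℕ→ℚ 3 * u a 0 * ℕ→ℚ (2 ℕ.* k)           ≡⟨ ℚₚ.*-assoc (ℕ→ℚ 3) (u a 0) _ ⟩
    ℕ→ℚ 3 * (u a 0 * ℕ→ℚ (2 ℕ.* k))         ≡⟨ cong (ℕ→ℚ 3 *_) (u-*-2k a) ⟩
    ℕ→ℚ 3 * binom                           ≡⟨ cong₂ _*_ (÷ℕ-*-cancel (ℕ→ℚ 3) 2 (λ ())) (÷ℕ-*-cancel binom k (λ ())) ⟨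
    (3/2 * ℕ→ℚ 2) * (binom2k/k k * ℕ→ℚ k)   ≡⟨ solve 4 (λ h t b K → (h :* t) :* (b :* K) := (h :* b) :* (t :* K)) refl 3/2 (ℕ→ℚ 2) (binom2k/k k) (ℕ→ℚ k) ⟩
    3/2 * binom2k/k k * (ℕ→ℚ 2 * ℕ→ℚ k)     ≡⟨ cong (3/2 * binom2k/k k *_) (ℕ→ℚ-homo-* 2 k) ⟨
    3/2 * binom2k/k k * ℕ→ℚ (2 ℕ.* k)       ∎)
    where
    k = suc a
    binom = ℕ→ℚ ((2 ℕ.* k) C k)


  Σ<-summand≡k*σ : ∀ a n → Σ< n (summand (suc a)) ≡ ℕ→ℚ (suc a) * σ a n
  Σ<-summand≡k*σ a n = trans (Σ<≡∑ n (summand (suc a))) (trans (∑-cong n (λ j _ → summand≡k*u a j)) (∑-*ˡ n (ℕ→ℚ (suc a)) (u a)))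

  k*target : ∀ k → k ≢ 0 →
    (ℕ→ℚ (3 ℕ.* k) ÷ℕ 2) * Σ< k (λ i → binom2k/k (i ℕ.+ 1)) - 3/2 * ℕ→ℚ ((2 ℕ.* k) C k) ≡ ℕ→ℚ k * target k
  k*target k k≢0 = begin
    (ℕ→ℚ (3 ℕ.* k) ÷ℕ 2) * Σ< k b - 3/2 * ℕ→ℚ ((2 ℕ.* k) C k)
      ≡⟨ cong₂ (λ x y → x * Σ< k b - 3/2 * y) 3k/2≡3/2*k (÷ℕ-*-cancel (ℕ→ℚ ((2 ℕ.* k) C k)) k k≢0) ⟨
    (3/2 * K) * Σ< k b - 3/2 * (binom2k/k k * K)
      ≡⟨ cong (λ s → (3/2 * K) * s - 3/2 * (binom2k/k k * K)) (Σ<≡∑ k b) ⟩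
    (3/2 * K) * ∑ k b - 3/2 * (binom2k/k k * K)
      ≡⟨ solve 4 (λ h K s x → (h :* K) :* s :- h :* (x :* K) := K :* (h :* (s :- x))) refl 3/2 K (∑ k b) (binom2k/k k) ⟩
    K * target k
      ∎
    where
    K = ℕ→ℚ k
    b : ℕ → ℚ
    b i = binom2k/k (i ℕ.+ 1)
    3k/2≡3/2*k : 3/2 * K ≡ ℕ→ℚ (3 ℕ.* k) ÷ℕ 2
    3k/2≡3/2*k = trans (÷ℕ-*-comm (ℕ→ℚ 3) K 2) (cong (_÷ℕ 2) (sym (ℕ→ℚ-homo-* 3 k)))

module Main (p : ℕ) (p-prime : Prime p) (2<p : 2 < p) where

  open Rationals
  open Coefficients
  open Summand
  open Congruence p p-prime
  open import Data.Nat as ℕ using (ℕ; zero; suc; s≤s; z≤n)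
  import Data.Nat.Properties as ℕₚ
  open import Data.Nat.Tactic.RingSolver using (solve-∀)
  open import Data.Rational using (0ℚ; _+_; _*_; -_)
  open import Data.Nat.Divisibility using (_∣_; >⇒∤)
  open import Relation.Nullary using (¬_)
  open import Relation.Binary.PropositionalEquality

  m+[1+n]≡p⇒m<p : ∀ {m n} → m ℕ.+ suc n ≡ p → m ℕ.< p
  m+[1+n]≡p⇒m<p {m} m+[1+n]≡p = subst (m ℕ.<_) m+[1+n]≡p (ℕₚ.m<m+n m (s≤s z≤n))

  σ≈target : ∀ a L → suc (a ℕ.+ a ℕ.+ L) ≡ p → σ a L ≈ target (suc a)
  σ≈target zero L 1+L≡p = ≈-trans harmonic (≈-reflexive (sym target-one))
    where
    harmonic : σ 0 L ≈ 0ℚ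
    harmonic = subst (_≈ 0ℚ) (∑-cong L (λ j _ → sym (u-zero j))) (harmonic≈0 (>⇒∤ 2<p) L 1+L≡p)
  σ≈target (suc a) L 2a+3+L≡p =
    ≈-trans step (≈-trans (≈-+ IH (≈-reflexive (3u≡3/2*binom2k/k a))) (≈-reflexive (sym (target-suc (suc a)))))
    where
    IH : σ a (2 ℕ.+ L) ≈ target (suc a)
    IH = σ≈target a (2 ℕ.+ L) (trans (shift a L) 2a+3+L≡p)
      where
      shift : ∀ a L → suc (a ℕ.+ a ℕ.+ (2 ℕ.+ L)) ≡ suc (suc a ℕ.+ suc a ℕ.+ L)
      shift = solve-∀
    step : σ (suc a) L ≈ σ a (2 ℕ.+ L) + ℕ→ℚ 3 * u a 0
    step = congruent (- (w a L ÷ℕ suc a)) (integral-neg (integral-÷ℕ (suc a) p∤k w-integral))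
           (trans (σ-step a L) (cong (λ n → ℕ→ℚ n * - (w a L ÷ℕ suc a)) (trans (e₁ a L) 2a+3+L≡p)))
      where
      e₁ : ∀ a L → 3 ℕ.+ a ℕ.+ a ℕ.+ L ≡ suc (suc a ℕ.+ suc a ℕ.+ L)
      e₁ = solve-∀
      e₂ : ∀ a L → suc (a ℕ.+ suc L) ℕ.+ suc a ≡ suc (suc a ℕ.+ suc a ℕ.+ L)
      e₂ = solve-∀
      a+L+2<p : suc (a ℕ.+ suc L) ℕ.< p
      a+L+2<p = m+[1+n]≡p⇒m<p (trans (e₂ a L) 2a+3+L≡p)
      p∤k : ¬ p ∣ suc a
      p∤k = >⇒∤ (ℕₚ.≤-<-trans (s≤s (ℕₚ.m≤m+n a (suc L))) a+L+2<p)
      p∤denom : ¬ p ∣ denom a (suc L)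
      p∤denom = p∤* (p∤! (suc (a ℕ.+ suc L)) a+L+2<p) (p∤! (suc (a ℕ.+ suc L)) a+L+2<p)
      w-integral : Integral (w a L)
      w-integral = integral-frac (numer a L ℕ.* c a L ℕ.* (3 ℕ.+ a ℕ.+ (L ℕ.+ L))) (denom a (suc L)) p∤denom


open import Data.Nat using (suc; _+_; _*_; _∸_; _≤_; _/_)
open import Data.Nat.Properties using (*-monoʳ-≤; *-comm; m∸n≤m; m+[n∸m]≡n; <-trans; n<1+n; module ≤-Reasoning)
open import Data.Nat.DivMod using (m/n*n≤m)
open import Data.Nat.Tactic.RingSolver using (solve-∀)
open import Data.Nat.Combinatorics using (_C_)
open import Data.Integer using (-_; +_)
open import Data.Rational using () renaming (_+_ to _+ℚ_; _*_ to _*ℚ_; _-_ to _-ℚ_)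
open import Relation.Binary.PropositionalEquality using (_≡_; sym; trans; subst₂)

2k≤p : ∀ p k → k ≤ (p ∸ 1) / 2 → 2 * k ≤ p
2k≤p p k k≤⌊p-1⌋/2 = begin
  2 * k              ≤⟨ *-monoʳ-≤ 2 k≤⌊p-1⌋/2 ⟩
  2 * ((p ∸ 1) / 2)  ≡⟨ *-comm 2 ((p ∸ 1) / 2) ⟩
  (p ∸ 1) / 2 * 2    ≤⟨ m/n*n≤m (p ∸ 1) 2 ⟩
  p ∸ 1              ≤⟨ m∸n≤m p 1 ⟩
  p                  ∎
  where open ≤-Reasoning

range-length : ∀ p a → 2 * suc a ≤ p → suc (a + a + (p ∸ 2 * suc a + 1)) ≡ p
range-length p a 2k≤p = trans (polynomial a (p ∸ 2 * suc a)) (m+[n∸m]≡n 2k≤p)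
  where
  polynomial : ∀ a x → suc (a + a + (x + 1)) ≡ 2 * suc a + x
  polynomial = solve-∀

lemma2p4 : (p : ℕ) → Prime p → 3 < p → (k : ℕ) → 1 ≤ k → k ≤ (p ∸ 1) / 2 →
    Σ< (p ∸ 2 * k + 1) (λ j → (gbinom (- (+ k)) (k + j) *ℚ sgn (k + j)) ÷ℕ ((k + j) C k))
      ≡ ((ℕ→ℚ (3 * k) ÷ℕ 2) *ℚ Σ< k (λ i → ℕ→ℚ ((2 * (i + 1)) C (i + 1)) ÷ℕ (i + 1))
          -ℚ ((ℕ→ℚ 3 ÷ℕ 2) *ℚ ℕ→ℚ ((2 * k) C k)))
      [modℚ p ]
lemma2p4 p p-prime 3<p (suc a) _ k≤⌊p-1⌋/2 =
  subst₂ (λ x y → x ≡ y [modℚ p ]) (sym (Σ<-summand≡k*σ a n)) (sym (k*target (suc a) (λ ())))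
    (≈⇒≡[modℚ] (≈-*ˡ (integral-ℕ→ℚ (suc a)) (σ≈target a n (range-length p a (2k≤p p (suc a) k≤⌊p-1⌋/2)))))
  where
  open Rationals
  open Summand
  open Congruence p p-prime
  open Main p p-prime (<-trans (n<1+n 2) 3<p)
  n = p ∸ 2 * suc a + 1
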